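{- Let $K$ be a cubic field whose discriminant $d_K$ is fundamental and satisfies $3\nmid d_K$. Let $F_K=(a,b,c,d)$ be a binary cubic form in the $\mathrm{GL}_2(\mathbb{Z})$-equivalence class associated to $K$, with Hessian $H_K=(P,Q,R)$, $P=b^2-3ac$, $Q=bc-9ad$, $R=c^2-3bd$. Let $\frac12 q_K$ denote the binary quadratic form $x\mapsto \frac12\mathrm{tr}_{K/\mathbb{Q}}(x^2)$ on $O_K^0$ written in the following $\mathbb{Z}$-basis of $O_K^0$: $\{\alpha_0,3\beta_0\}$ if $b\equiv 0\pmod 3$; $\{3\alpha_0,\beta_0\}$ if $c\equiv 0 \pmod 3$; $\{\alpha_0-\beta_0,3\beta_0\}$ if $b\equiv -c\pmod 3$; $\{\alpha_0+\beta_0,3\beta_0\}$ if $b\equiv c\pmod 3$. Let $C_{d_K}=(3,0,\frac{d_K}{4})$ if $d_K\equiv 0\pmod 4$ and $C_{d_K}=(3,3,\frac{d_K+3}{4})$ if $d_K\equiv 1\pmod 4$. Then $$\tfrac12 q_K * C_{d_K} = H_K^{\pm 1}$$ as elements of the narrow class group $\mathrm{Cl}^+_{\mathbb{Q}(\sqrt{ -3d_K})}$.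
   Context: A discriminant is fundamental if it is the discriminant of a quadratic field. $(A,B,C)$ denotes the binary quadratic form $Ax^2+Bxy+Cy^2$ (discriminant $B^2-4AC$), and $(a,b,c,d)$ the binary cubic form $ax^3+bx^2y+cxy^2+dy^3$. By the Delone–Faddeev correspondence, to a cubic field $K$ is associated an integral binary cubic form $F_K=(a,b,c,d)$, unique up to $\mathrm{GL}_2(\mathbb{Z})$-equivalence, with discriminant $d_K$, such that if $\theta$ is a root of $F_K(x,1)$ then $K=\mathbb{Q}(\theta)$ and $\{1,-a\theta, d/\theta\}$ is a $\mathbb{Z}$-basis of $O_K$. Put $\alpha=-a\theta$, $\beta=d/\theta$, $\alpha_0=\alpha-\frac{\mathrm{tr}_{K/\mathbb{Q}}(\alpha)}{3}$, $\beta_0=\beta-\frac{\mathrm{tr}_{K/\mathbb{Q}}(\beta)}{3}$. $O_K^0=\{x\in O_K:\mathrm{tr}_{K/\mathbb{Q}}(x)=0\}$. The narrow class group $\mathrm{Cl}^+_{\mathbb{Q}(\sqrt{\Delta})}$ is identified, via Gauss composition $*$, with the group of $\mathrm{SL}_2(\mathbb{Z})$-classes of primitive integral binary quadratic forms of discriminant $\Delta$. -}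

module Defs where

open import Data.Nat as ℕ using (ℕ)
import Data.Nat.Divisibility as ℕD
open import Data.Integer using (ℤ; +_; _+_; _-_; _*_; -_)
import Data.Integer as ℤ
open import Data.Integer.Divisibility using (_∣_)
open import Data.Product using (Σ; ∃; ∃-syntax; _×_; _,_)
open import Data.Sum using (_⊎_)
open import Relation.Binary.PropositionalEquality using (_≡_; _≢_)
open import Relation.Nullary using (¬_)

-- squarefree integer: the only natural k with k² ∣ |D| is k = 1
-- (so 0 is not squarefree)
Squarefree : ℤ → Set
Squarefree D = (k : ℕ) → (k ℕ.* k) ℕD.∣ ℤ.∣ D ∣ → k ≡ 1

IsFundamental : ℤ → Set
IsFundamental D =
  (D ≢ + 1) ×
  ( ((+ 4) ∣ (D - + 1) × Squarefree D)
  ⊎ (∃[ m ] (D ≡ + 4 * m × (((+ 4) ∣ (m - + 2)) ⊎ ((+ 4) ∣ (m - + 3))) × Squarefree m)))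

-- Binary cubic forms (a,b,c,d) = a x³ + b x² y + c x y² + d y³

discCubic : ℤ → ℤ → ℤ → ℤ → ℤ
discCubic a b c d =
  b * b * c * c - + 4 * a * c * c * c - + 4 * b * b * b * d
  - + 27 * a * a * d * d + + 18 * a * b * c * d

-- F is reducible over ℚ iff (Gauss's lemma) it factors as a product of an
-- integral linear form (l₁ x + l₂ y) and an integral quadratic form
-- (q₁ x² + q₂ x y + q₃ y²).
ReducibleCubic : ℤ → ℤ → ℤ → ℤ → Set
ReducibleCubic a b c d =
  ∃[ l₁ ] ∃[ l₂ ] ∃[ q₁ ] ∃[ q₂ ] ∃[ q₃ ]
    ( a ≡ l₁ * q₁ × b ≡ l₁ * q₂ + l₂ * q₁
    × c ≡ l₁ * q₃ + l₂ * q₂ × d ≡ l₂ * q₃ )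

IrreducibleCubic : ℤ → ℤ → ℤ → ℤ → Set
IrreducibleCubic a b c d = ¬ ReducibleCubic a b c d

-- The cubic ring attached to (a,b,c,d): elements are integer coordinate
-- triples (z₀ , z₁ , z₂) meaning z₀ + z₁ α + z₂ β, with α = -aθ, β = d/θ,
-- θ a root of F(x,1).  Multiplication table (derived from F(θ,1) = 0):
--   α² = -ac + bα - aβ ,  αβ = -ad ,  β² = -bd + dα - cβ .

Elt : Set
Elt = ℤ × ℤ × ℤ

mulElt : ℤ → ℤ → ℤ → ℤ → Elt → Elt → Elt
mulElt a b c d (x₀ , x₁ , x₂) (y₀ , y₁ , y₂) =
  let s  = x₁ * y₁
      t  = x₁ * y₂ + x₂ * y₁
      u  = x₂ * y₂
  in ( x₀ * y₀ + s * (- (a * c)) + t * (- (a * d)) + u * (- (b * d))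
     , x₀ * y₁ + x₁ * y₀ + s * b + u * d
     , x₀ * y₂ + x₂ * y₀ + s * (- a) + u * (- c) )

-- trace K/ℚ: tr 1 = 3, tr α = b, tr β = -c
trElt : ℤ → ℤ → ℤ → ℤ → Elt → ℤ
trElt a b c d (z₀ , z₁ , z₂) = + 3 * z₀ + b * z₁ - c * z₂

-- The bases of O_K^0 of the statement, recorded as (3e₁ , 3e₂)
-- (multiplied by 3 so as to have integral coordinates):
--   3α₀ = 3α - b = (-b,3,0) ,  3β₀ = 3β + c = (c,0,3).

data TraceZeroBasis (a b c d : ℤ) : Elt → Elt → Set where
  -- b ≡ 0 (mod 3): {α₀ , 3β₀}
  case-b : (+ 3) ∣ b →
    TraceZeroBasis a b c d (- b , + 3 , + 0) (+ 3 * c , + 0 , + 9)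
  -- c ≡ 0 (mod 3): {3α₀ , β₀}
  case-c : (+ 3) ∣ c →
    TraceZeroBasis a b c d (- (+ 3 * b) , + 9 , + 0) (c , + 0 , + 3)
  -- b ≡ -c (mod 3): {α₀ - β₀ , 3β₀}
  case-b≡-c : (+ 3) ∣ (b + c) →
    TraceZeroBasis a b c d (- b - c , + 3 , - (+ 3)) (+ 3 * c , + 0 , + 9)
  -- b ≡ c (mod 3): {α₀ + β₀ , 3β₀}
  case-b≡c : (+ 3) ∣ (b - c) →
    TraceZeroBasis a b c d (- b + c , + 3 , + 3) (+ 3 * c , + 0 , + 9)

-- Binary quadratic forms (A,B,C) = A x² + B x y + C y²

QF : Set
QF = ℤ × ℤ × ℤ

-- ½ q_K in the basis {e₁,e₂} equals (A,B,C) where, with E_i = 3 e_i,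
--   A = ½ tr(e₁²) , B = tr(e₁e₂) , C = ½ tr(e₂²), i.e.
--   18 A = tr(E₁²), 9 B = tr(E₁E₂), 18 C = tr(E₂²).
IsHalfTraceForm : ℤ → ℤ → ℤ → ℤ → Elt → Elt → QF → Set
IsHalfTraceForm a b c d E₁ E₂ (A , B , C) =
    + 18 * A ≡ trElt a b c d (mulElt a b c d E₁ E₁)
  × + 9 * B ≡ trElt a b c d (mulElt a b c d E₁ E₂)
  × + 18 * C ≡ trElt a b c d (mulElt a b c d E₂ E₂)

-- proper (SL₂(ℤ)) equivalence: g(x,y) = f(px+qy, rx+sy), ps - qr = 1
_∼_ : QF → QF → Set
(A , B , C) ∼ (A' , B' , C') =
  ∃[ p ] ∃[ q ] ∃[ r ] ∃[ s ]
    ( p * s - q * r ≡ + 1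
    × A' ≡ A * p * p + B * p * r + C * r * r
    × B' ≡ + 2 * A * p * q + B * (p * s + q * r) + + 2 * C * r * s
    × C' ≡ A * q * q + B * q * s + C * s * s )

-- [f] * [g] = [h] in the form class group (Gauss composition), via
-- Dirichlet composition of concordant (united) forms:
-- f ∼ (a₁, B, a₂C), g ∼ (a₂, B, a₁C) with gcd(a₁,a₂,B) = 1,
-- whose composite is (a₁a₂, B, C); and h ∼ (a₁a₂, B, C).
Composes : QF → QF → QF → Set
Composes f g h =
  ∃[ a₁ ] ∃[ a₂ ] ∃[ B ] ∃[ C ]
    ( ((k : ℤ) → k ∣ a₁ → k ∣ a₂ → k ∣ B → k ∣ + 1)
    × f ∼ (a₁ , B , a₂ * C)
    × g ∼ (a₂ , B , a₁ * C)
    × h ∼ (a₁ * a₂ , B , C) )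

IsCForm : ℤ → QF → Set
IsCForm D g =
    (∃[ m ] (D ≡ + 4 * m × g ≡ (+ 3 , + 0 , m)))
  ⊎ (∃[ m ] (D + + 3 ≡ + 4 * m × g ≡ (+ 3 , + 3 , m)))

hessian : ℤ → ℤ → ℤ → ℤ → QF
hessian a b c d = (b * b - + 3 * a * c , b * c - + 9 * a * d , c * c - + 3 * b * d)

invQF : QF → QF
invQF (A , B , C) = (A , - B , C)

{-# OPTIONS --safe #-}

-- For trace-zero x, y ∈ O_K with α,β-coordinates (x₁, x₂), (y₁, y₂) one has
-- 3 tr(xy) = 2P x₁y₁ + Q (x₁y₂ + x₂y₁) + 2R x₂y₂, the polar form of the Hessian (P, Q, R).
-- Hence ½q_K is the Hessian H_K pulled back along the coordinate matrix of the basis, divided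
-- by 27. The congruence attached to each basis makes a shear (or the swap) of H_K equal to
-- (3A, 3B, C), and then ½q_K is (A, 3B, 3C) (or its swap). Since disc H_K = -3 d_K, this gives
-- d_K = 4AC - 3B², so 3 ∤ A, and (A, 3B, 3C), (3, 3B, AC) are concordant with Dirichlet
-- composite (3A, 3B, C) ∼ H_K. Finally (3, 3B, AC) is a translate of C_{d_K}, the parity of B
-- being forced by d_K mod 4.
module Submission where

open import Data.Empty using (⊥-elim)
open import Data.Integer using (ℤ; +_; _+_; _-_; _*_; -_; _/_; _%_)
import Data.Integer as ℤ
open import Data.Integer.Divisibility using (_∣_)
import Data.Integer.Divisibility.Signed as Signed
open import Data.Integer.DivMod using (a≡a%n+[a/n]*n; n%d<d)
open import Data.Integer.Properties
  using (*-cancelˡ-≡; *-comm; *-assoc; *-identityˡ; +-identityˡ; +-comm; neg-involutive)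
open import Data.Integer.Tactic.RingSolver using (solve-∀; solve)
open import Data.List using (_∷_; [])
import Data.Nat as ℕ
import Data.Nat.Divisibility as ℕ
open import Data.Nat.Primality using (prime⇒irreducible; prime?)
open import Data.Product using (∃-syntax; _×_; _,_; proj₁; proj₂)
open import Data.Sum using (_⊎_; inj₁; inj₂)
open import Relation.Binary.PropositionalEquality
open import Relation.Nullary using (¬_)
open import Relation.Nullary.Decidable using (toWitness)
open ≡-Reasoning

open import Defs

discQF : QF → ℤ
discQF (A , B , C) = B * B - + 4 * A * C

swap : QF → QF
swap (A , B , C) = (C , - B , A)

shear : ℤ → QF → QF
shear t (A , B , C) = (A + B * t + C * t * t , B + + 2 * C * t , C)

translate : ℤ → QF → QF
translate t (A , B , C) = (A , B + + 2 * A * t , A * t * t + B * t + C)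

∼-refl : ∀ {A B C} → (A , B , C) ∼ (A , B , C)
∼-refl {A} {B} {C} =
  + 1 , + 0 , + 0 , + 1 , refl ,
  solve (A ∷ B ∷ C ∷ []) , solve (A ∷ B ∷ C ∷ []) , solve (A ∷ B ∷ C ∷ [])

∼-swap : ∀ H → H ∼ swap H
∼-swap (A , B , C) = swapped
  where
  swapped : (A , B , C) ∼ (C , - B , A)
  swapped = + 0 , - + 1 , + 1 , + 0 , refl ,
    solve (A ∷ B ∷ C ∷ []) , solve (A ∷ B ∷ C ∷ []) , solve (A ∷ B ∷ C ∷ [])

∼-shear : ∀ t H → H ∼ shear t H
∼-shear t (A , B , C) = sheared
  where
  sheared : (A , B , C) ∼ (A + B * t + C * t * t , B + + 2 * C * t , C)
  sheared = + 1 , + 0 , t , + 1 , solve (t ∷ []) ,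
    solve (A ∷ B ∷ C ∷ t ∷ []) , solve (A ∷ B ∷ C ∷ t ∷ []) , solve (A ∷ B ∷ C ∷ t ∷ [])

∼-translate : ∀ t H → H ∼ translate t H
∼-translate t (A , B , C) = translated
  where
  translated : (A , B , C) ∼ (A , B + + 2 * A * t , A * t * t + B * t + C)
  translated = + 1 , t , + 0 , + 1 , solve (t ∷ []) ,
    solve (A ∷ B ∷ C ∷ t ∷ []) , solve (A ∷ B ∷ C ∷ t ∷ []) , solve (A ∷ B ∷ C ∷ t ∷ [])

∼-discQF : ∀ {f g} → f ∼ g → discQF g ≡ discQF f
∼-discQF {A , B , C} (p , q , r , s , det , refl , refl , refl) = begin
  (+ 2 * A * p * q + B * (p * s + q * r) + + 2 * C * r * s)
    * (+ 2 * A * p * q + B * (p * s + q * r) + + 2 * C * r * s)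
    - + 4 * (A * p * p + B * p * r + C * r * r) * (A * q * q + B * q * s + C * s * s)
      ≡⟨ solve (A ∷ B ∷ C ∷ p ∷ q ∷ r ∷ s ∷ []) ⟩
  (p * s - q * r) * (p * s - q * r) * (B * B - + 4 * A * C)
      ≡⟨ cong (λ δ → δ * δ * (B * B - + 4 * A * C)) det ⟩
  + 1 * + 1 * (B * B - + 4 * A * C)
      ≡⟨ *-identityˡ _ ⟩
  B * B - + 4 * A * C ∎

polar : QF → ℤ × ℤ → ℤ × ℤ → ℤ
polar (P , Q , R) (x₁ , x₂) (y₁ , y₂) =
  + 2 * P * x₁ * y₁ + Q * (x₁ * y₂ + x₂ * y₁) + + 2 * R * x₂ * y₂

polar-shear : ∀ t H {A B C} → shear t H ≡ (+ 3 * A , + 3 * B , C) →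
    polar H (+ 3 , + 3 * t) (+ 3 , + 3 * t) ≡ + 54 * A
  × polar H (+ 3 , + 3 * t) (+ 0 , + 9) ≡ + 27 * (+ 3 * B)
  × polar H (+ 0 , + 9) (+ 0 , + 9) ≡ + 54 * (+ 3 * C)
polar-shear t (P , Q , R) {A} {B} {C} eq =
  ( begin
      + 2 * P * + 3 * + 3 + Q * (+ 3 * (+ 3 * t) + + 3 * t * + 3) + + 2 * R * (+ 3 * t) * (+ 3 * t)
        ≡⟨ solve (P ∷ Q ∷ R ∷ t ∷ []) ⟩
      + 18 * (P + Q * t + R * t * t)
        ≡⟨ cong (_*_ (+ 18)) (cong proj₁ eq) ⟩
      + 18 * (+ 3 * A)
        ≡⟨ *-assoc (+ 18) (+ 3) A ⟨
      + 54 * A ∎ )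
  , ( begin
      + 2 * P * + 3 * + 0 + Q * (+ 3 * + 9 + + 3 * t * + 0) + + 2 * R * (+ 3 * t) * + 9
        ≡⟨ solve (P ∷ Q ∷ R ∷ t ∷ []) ⟩
      + 27 * (Q + + 2 * R * t)
        ≡⟨ cong (_*_ (+ 27)) (cong (λ f → proj₁ (proj₂ f)) eq) ⟩
      + 27 * (+ 3 * B) ∎ )
  , ( begin
      + 2 * P * + 0 * + 0 + Q * (+ 0 * + 9 + + 9 * + 0) + + 2 * R * + 9 * + 9
        ≡⟨ solve (P ∷ Q ∷ R ∷ []) ⟩
      + 54 * (+ 3 * R)
        ≡⟨ cong (λ x → + 54 * (+ 3 * x)) (cong (λ f → proj₂ (proj₂ f)) eq) ⟩
      + 54 * (+ 3 * C) ∎ )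

polar-swap : ∀ H {A B C} → swap H ≡ (+ 3 * A , + 3 * B , C) →
    polar H (+ 9 , + 0) (+ 9 , + 0) ≡ + 54 * (+ 3 * C)
  × polar H (+ 9 , + 0) (+ 0 , + 3) ≡ + 27 * - (+ 3 * B)
  × polar H (+ 0 , + 3) (+ 0 , + 3) ≡ + 54 * A
polar-swap (P , Q , R) {A} {B} {C} eq =
  ( begin
      + 2 * P * + 9 * + 9 + Q * (+ 9 * + 0 + + 0 * + 9) + + 2 * R * + 0 * + 0
        ≡⟨ solve (P ∷ Q ∷ R ∷ []) ⟩
      + 54 * (+ 3 * P)
        ≡⟨ cong (λ x → + 54 * (+ 3 * x)) (cong (λ f → proj₂ (proj₂ f)) eq) ⟩
      + 54 * (+ 3 * C) ∎ )
  , ( begin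
      + 2 * P * + 9 * + 0 + Q * (+ 9 * + 3 + + 0 * + 0) + + 2 * R * + 0 * + 3
        ≡⟨ solve (P ∷ Q ∷ R ∷ []) ⟩
      + 27 * - - Q
        ≡⟨ cong (λ x → + 27 * - x) (cong (λ f → proj₁ (proj₂ f)) eq) ⟩
      + 27 * - (+ 3 * B) ∎ )
  , ( begin
      + 2 * P * + 0 * + 0 + Q * (+ 0 * + 3 + + 3 * + 0) + + 2 * R * + 3 * + 3
        ≡⟨ solve (P ∷ Q ∷ R ∷ []) ⟩
      + 18 * R
        ≡⟨ cong (_*_ (+ 18)) (cong proj₁ eq) ⟩
      + 18 * (+ 3 * A)
        ≡⟨ *-assoc (+ 18) (+ 3) A ⟨
      + 54 * A ∎ )

4*x≢3 : ∀ x → + 4 * x ≢ + 3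
4*x≢3 x 4x≡3 with ℕ.∣⇒≤ (Signed.∣⇒∣ᵤ 4∣3)
  where
  4∣3 : + 4 Signed.∣ + 3
  4∣3 = subst (+ 4 Signed.∣_) 4x≡3 (Signed.divides x (*-comm (+ 4) x))
... | ℕ.s≤s (ℕ.s≤s (ℕ.s≤s ()))

even-or-odd : ∀ n → ∃[ t ] (n ≡ + 2 * t ⊎ n ≡ + 2 * t + + 1)
even-or-odd n with n % + 2 | n / + 2 | n%d<d n (+ 2) | a≡a%n+[a/n]*n n (+ 2)
... | 0 | t | _ | n≡ = t , inj₁ (trans n≡ (trans (+-identityˡ (t * + 2)) (*-comm t (+ 2))))
... | 1 | t | _ | n≡ = t , inj₂ (trans n≡ (trans (+-comm (+ 1) (t * + 2)) (cong (_+ + 1) (*-comm t (+ 2)))))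
... | ℕ.suc (ℕ.suc _) | _ | ℕ.s≤s (ℕ.s≤s ()) | _

IsCForm⇒∼ : ∀ {D g} A B C → D ≡ + 4 * A * C - + 3 * B * B → IsCForm D g →
  g ∼ (+ 3 , + 3 * B , A * C)
IsCForm⇒∼ A B C refl C-form with even-or-odd B | C-form
... | t , inj₁ refl | inj₁ (m , D≡4m , refl) =
  subst ((+ 3 , + 0 , m) ∼_) (cong₂ _,_ refl (cong₂ _,_ middle last)) (∼-translate t (+ 3 , + 0 , m))
  where
  middle : + 0 + + 2 * + 3 * t ≡ + 3 * (+ 2 * t)
  middle = solve (t ∷ [])
  last : + 3 * t * t + + 0 * t + m ≡ A * C
  last = *-cancelˡ-≡ (+ 4) _ _ (begin
    + 4 * (+ 3 * t * t + + 0 * t + m)                            ≡⟨ solve (t ∷ m ∷ []) ⟩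
    + 12 * t * t + + 4 * m                                        ≡⟨ cong (_+_ (+ 12 * t * t)) D≡4m ⟨
    + 12 * t * t + (+ 4 * A * C - + 3 * (+ 2 * t) * (+ 2 * t))   ≡⟨ solve (A ∷ C ∷ t ∷ []) ⟩
    + 4 * (A * C)                                                 ∎)
... | t , inj₁ refl | inj₂ (m , D+3≡4m , refl) = ⊥-elim (4*x≢3 (m - A * C + + 3 * t * t) (begin
    + 4 * (m - A * C + + 3 * t * t)                                         ≡⟨ solve (A ∷ C ∷ t ∷ m ∷ []) ⟩
    + 4 * m - (+ 4 * A * C - + 3 * (+ 2 * t) * (+ 2 * t) + + 3) + + 3      ≡⟨ cong (λ x → + 4 * m - x + + 3) D+3≡4m ⟩
    + 4 * m - + 4 * m + + 3                                                 ≡⟨ solve (m ∷ []) ⟩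
    + 3                                                                     ∎))
... | t , inj₂ refl | inj₁ (m , D≡4m , refl) = ⊥-elim (4*x≢3 (A * C - m - + 3 * t * t - + 3 * t) (begin
    + 4 * (A * C - m - + 3 * t * t - + 3 * t)                                      ≡⟨ solve (A ∷ C ∷ t ∷ m ∷ []) ⟩
    + 4 * A * C - + 3 * (+ 2 * t + + 1) * (+ 2 * t + + 1) - + 4 * m + + 3          ≡⟨ cong (λ x → x - + 4 * m + + 3) D≡4m ⟩
    + 4 * m - + 4 * m + + 3                                                        ≡⟨ solve (m ∷ []) ⟩
    + 3                                                                            ∎))
... | t , inj₂ refl | inj₂ (m , D+3≡4m , refl) =
  subst ((+ 3 , + 3 , m) ∼_) (cong₂ _,_ refl (cong₂ _,_ middle last)) (∼-translate t (+ 3 , + 3 , m))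
  where
  middle : + 3 + + 2 * + 3 * t ≡ + 3 * (+ 2 * t + + 1)
  middle = solve (t ∷ [])
  last : + 3 * t * t + + 3 * t + m ≡ A * C
  last = *-cancelˡ-≡ (+ 4) _ _ (begin
    + 4 * (+ 3 * t * t + + 3 * t + m)                                                  ≡⟨ solve (t ∷ m ∷ []) ⟩
    + 12 * t * t + + 12 * t + + 4 * m                                                  ≡⟨ cong (_+_ (+ 12 * t * t + + 12 * t)) D+3≡4m ⟨
    + 12 * t * t + + 12 * t + (+ 4 * A * C - + 3 * (+ 2 * t + + 1) * (+ 2 * t + + 1) + + 3) ≡⟨ solve (A ∷ C ∷ t ∷ []) ⟩
    + 4 * (A * C)                                                                      ∎)

composes-with-CForm : ∀ {D f g h} A B C → ¬ (+ 3 ∣ D) → D ≡ + 4 * A * C - + 3 * B * B → IsCForm D g →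
  f ∼ (A , + 3 * B , + 3 * C) → h ∼ (+ 3 * A , + 3 * B , C) → Composes f g h
composes-with-CForm {h = h} A B C 3∤D D≡ C-form f∼ h∼ =
  A , + 3 , + 3 * B , C , coprime , f∼ , IsCForm⇒∼ A B C D≡ C-form ,
  subst (λ x → h ∼ (x , + 3 * B , C)) (*-comm (+ 3) A) h∼
  where
  coprime : ∀ k → k ∣ A → k ∣ + 3 → k ∣ + 3 * B → k ∣ + 1
  coprime k k∣A k∣3 _ with prime⇒irreducible (toWitness {a? = prime? 3} _) k∣3
  ... | inj₁ ∣k∣≡1 = subst (ℕ._∣ 1) (sym ∣k∣≡1) ℕ.∣-refl
  ... | inj₂ ∣k∣≡3 = ⊥-elim (3∤D (subst (+ 3 ∣_) (sym D≡) (Signed.∣⇒∣ᵤ 3∣disc)))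
    where
    3∣A : + 3 Signed.∣ A
    3∣A = Signed.∣ᵤ⇒∣ (subst (ℕ._∣ ℤ.∣ A ∣) ∣k∣≡3 k∣A)
    3∣disc : + 3 Signed.∣ + 4 * A * C - + 3 * B * B
    3∣disc = Signed.∣m∣n⇒∣m-n (Signed.∣m⇒∣m*n C (Signed.∣n⇒∣m*n (+ 4) 3∣A))
                              (Signed.∣m⇒∣m*n B (Signed.∣m⇒∣m*n B Signed.∣-refl))

αβ : Elt → ℤ × ℤ
αβ (_ , x₁ , x₂) = (x₁ , x₂)

trace-mul-polar : ∀ a b c d X Y →
  + 3 * trElt a b c d (mulElt a b c d X Y)
    ≡ trElt a b c d X * trElt a b c d Y + polar (hessian a b c d) (αβ X) (αβ Y)
trace-mul-polar a b c d (x₀ , x₁ , x₂) (y₀ , y₁ , y₂) = unfolded a b c d x₀ x₁ x₂ y₀ y₁ y₂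
  where
  unfolded : ∀ a b c d x₀ x₁ x₂ y₀ y₁ y₂ →
    + 3 * (+ 3 * (x₀ * y₀ + x₁ * y₁ * - (a * c) + (x₁ * y₂ + x₂ * y₁) * - (a * d) + x₂ * y₂ * - (b * d))
          + b * (x₀ * y₁ + x₁ * y₀ + x₁ * y₁ * b + x₂ * y₂ * d)
          - c * (x₀ * y₂ + x₂ * y₀ + x₁ * y₁ * - a + x₂ * y₂ * - c))
      ≡ (+ 3 * x₀ + b * x₁ - c * x₂) * (+ 3 * y₀ + b * y₁ - c * y₂)
        + (+ 2 * (b * b - + 3 * a * c) * x₁ * y₁ + (b * c - + 9 * a * d) * (x₁ * y₂ + x₂ * y₁)
           + + 2 * (c * c - + 3 * b * d) * x₂ * y₂)
  unfolded = solve-∀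

trace-mul-traceless : ∀ a b c d X Y → trElt a b c d X ≡ + 0 → trElt a b c d Y ≡ + 0 →
  + 3 * trElt a b c d (mulElt a b c d X Y) ≡ polar (hessian a b c d) (αβ X) (αβ Y)
trace-mul-traceless a b c d X Y trX≡0 trY≡0 = begin
  + 3 * trElt a b c d (mulElt a b c d X Y)                  ≡⟨ trace-mul-polar a b c d X Y ⟩
  trElt a b c d X * trElt a b c d Y + H                     ≡⟨ cong₂ (λ u v → u * v + H) trX≡0 trY≡0 ⟩
  + 0 * + 0 + H                                             ≡⟨ +-identityˡ H ⟩
  H                                                         ∎
  where H = polar (hessian a b c d) (αβ X) (αβ Y)

polar⇒IsHalfTraceForm : ∀ a b c d E₁ E₂ {A B C} →
  trElt a b c d E₁ ≡ + 0 → trElt a b c d E₂ ≡ + 0 →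
    polar (hessian a b c d) (αβ E₁) (αβ E₁) ≡ + 54 * A
  × polar (hessian a b c d) (αβ E₁) (αβ E₂) ≡ + 27 * B
  × polar (hessian a b c d) (αβ E₂) (αβ E₂) ≡ + 54 * C →
  IsHalfTraceForm a b c d E₁ E₂ (A , B , C)
polar⇒IsHalfTraceForm a b c d E₁ E₂ {A} {B} {C} tr₁≡0 tr₂≡0 (p₁₁ , p₁₂ , p₂₂) =
    cancel-3 (+ 18) A (trans p₁₁ (*-assoc (+ 3) (+ 18) A)) (trace-mul-traceless a b c d E₁ E₁ tr₁≡0 tr₁≡0)
  , cancel-3 (+ 9) B (trans p₁₂ (*-assoc (+ 3) (+ 9) B)) (trace-mul-traceless a b c d E₁ E₂ tr₁≡0 tr₂≡0)
  , cancel-3 (+ 18) C (trans p₂₂ (*-assoc (+ 3) (+ 18) C)) (trace-mul-traceless a b c d E₂ E₂ tr₂≡0 tr₂≡0)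
  where
  cancel-3 : ∀ m n {p t} → p ≡ + 3 * (m * n) → + 3 * t ≡ p → m * n ≡ t
  cancel-3 m n p≡ 3t≡p = *-cancelˡ-≡ (+ 3) _ _ (trans (sym p≡) (sym 3t≡p))

hessian-discQF : ∀ a b c d → discQF (hessian a b c d) ≡ - + 3 * discCubic a b c d
hessian-discQF = unfolded
  where
  unfolded : ∀ a b c d →
    (b * c - + 9 * a * d) * (b * c - + 9 * a * d) - + 4 * (b * b - + 3 * a * c) * (c * c - + 3 * b * d)
      ≡ - + 3 * (b * b * c * c - + 4 * a * c * c * c - + 4 * b * b * b * d
                 - + 27 * a * a * d * d + + 18 * a * b * c * d)
  unfolded = solve-∀

reduced-hessian⇒discCubic : ∀ a b c d {A B C} → hessian a b c d ∼ (+ 3 * A , + 3 * B , C) →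
  discCubic a b c d ≡ + 4 * A * C - + 3 * B * B
reduced-hessian⇒discCubic a b c d {A} {B} {C} H∼ = *-cancelˡ-≡ (- + 3) _ _ (begin
  - + 3 * discCubic a b c d                          ≡⟨ hessian-discQF a b c d ⟨
  discQF (hessian a b c d)                            ≡⟨ ∼-discQF {hessian a b c d} H∼ ⟨
  + 3 * B * (+ 3 * B) - + 4 * (+ 3 * A) * C          ≡⟨ solve (A ∷ B ∷ C ∷ []) ⟩
  - + 3 * (+ 4 * A * C - + 3 * B * B)                ∎)

hessian-shear-reducible : ∀ a b c d t → + 3 ∣ b - t * c →
  ∃[ A ] ∃[ B ] ∃[ C ] shear t (hessian a b c d) ≡ (+ 3 * A , + 3 * B , C)
hessian-shear-reducible a b c d t 3∣b-tc with Signed.∣ᵤ⇒∣ 3∣b-tc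
... | Signed.divides k b-tc≡3k =
  subst (λ b → ∃[ A ] ∃[ B ] ∃[ C ] shear t (hessian a b c d) ≡ (+ 3 * A , + 3 * B , C)) tc+3k≡b
    (_ , _ , _ , cong₂ _,_ (head a c d t k) (cong₂ _,_ (middle a c d t k) refl))
  where
  tc+3k≡b : t * c + k * + 3 ≡ b
  tc+3k≡b = begin
    t * c + k * + 3         ≡⟨ cong (_+_ (t * c)) b-tc≡3k ⟨
    t * c + (b - t * c)     ≡⟨ solve (b ∷ c ∷ t ∷ []) ⟩
    b                       ∎
  head : ∀ a c d t k → let b = t * c + k * + 3 in
    b * b - + 3 * a * c + (b * c - + 9 * a * d) * t + (c * c - + 3 * b * d) * t * t
      ≡ + 3 * ( t * t * c * c + + 3 * t * c * k + + 3 * k * k - a * c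
              - + 3 * a * d * t - t * t * t * c * d - + 3 * k * d * t * t )
  head = solve-∀
  middle : ∀ a c d t k → let b = t * c + k * + 3 in
    b * c - + 9 * a * d + + 2 * (c * c - + 3 * b * d) * t
      ≡ + 3 * (t * c * c + k * c - + 3 * a * d - + 2 * t * t * c * d - + 6 * k * t * d)
  middle = solve-∀

hessian-swap-reducible : ∀ a b c d → + 3 ∣ c →
  ∃[ A ] ∃[ B ] ∃[ C ] swap (hessian a b c d) ≡ (+ 3 * A , + 3 * B , C)
hessian-swap-reducible a b c d 3∣c with Signed.∣ᵤ⇒∣ {+ 3} {c} 3∣c
... | Signed.divides k refl = _ , _ , _ , cong₂ _,_ (head b d k) (cong₂ _,_ (middle a b d k) refl)
  where
  head : ∀ b d k → k * + 3 * (k * + 3) - + 3 * b * d ≡ + 3 * (+ 3 * k * k - b * d)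
  head = solve-∀
  middle : ∀ a b d k → - (b * (k * + 3) - + 9 * a * d) ≡ + 3 * (+ 3 * a * d - b * k)
  middle = solve-∀

record HessianReduction (a b c d : ℤ) (E₁ E₂ : Elt) : Set where
  field
    A B C : ℤ
    q : QF
    isHalfTraceForm : IsHalfTraceForm a b c d E₁ E₂ q
    q∼ : q ∼ (A , + 3 * B , + 3 * C)
    hessian∼ : hessian a b c d ∼ (+ 3 * A , + 3 * B , C)

shear-reduction : ∀ a b c d t → + 3 ∣ b - t * c → ∀ {x₀} → x₀ ≡ t * c - b →
  HessianReduction a b c d (x₀ , + 3 , + 3 * t) (+ 3 * c , + 0 , + 9)
shear-reduction a b c d t 3∣b-tc refl with hessian-shear-reducible a b c d t 3∣b-tc
... | A , B , C , reduced = record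
  { A = A ; B = B ; C = C ; q = (A , + 3 * B , + 3 * C)
  ; isHalfTraceForm = polar⇒IsHalfTraceForm a b c d (t * c - b , + 3 , + 3 * t) (+ 3 * c , + 0 , + 9)
      traceless₁ traceless₂ (polar-shear t (hessian a b c d) reduced)
  ; q∼ = ∼-refl
  ; hessian∼ = subst (hessian a b c d ∼_) reduced (∼-shear t (hessian a b c d)) }
  where
  traceless₁ : + 3 * (t * c - b) + b * + 3 - c * (+ 3 * t) ≡ + 0
  traceless₁ = solve (b ∷ c ∷ t ∷ [])
  traceless₂ : + 3 * (+ 3 * c) + b * + 0 - c * + 9 ≡ + 0
  traceless₂ = solve (b ∷ c ∷ [])

swap-reduction : ∀ a b c d → + 3 ∣ c →
  HessianReduction a b c d (- (+ 3 * b) , + 9 , + 0) (c , + 0 , + 3)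
swap-reduction a b c d 3∣c with hessian-swap-reducible a b c d 3∣c
... | A , B , C , reduced = record
  { A = A ; B = B ; C = C ; q = (+ 3 * C , - (+ 3 * B) , A)
  ; isHalfTraceForm = polar⇒IsHalfTraceForm a b c d (- (+ 3 * b) , + 9 , + 0) (c , + 0 , + 3)
      traceless₁ traceless₂ (polar-swap (hessian a b c d) reduced)
  ; q∼ = subst (λ β → (+ 3 * C , - (+ 3 * B) , A) ∼ (A , β , + 3 * C)) (neg-involutive _)
          (∼-swap (+ 3 * C , - (+ 3 * B) , A))
  ; hessian∼ = subst (hessian a b c d ∼_) reduced (∼-swap (hessian a b c d)) }
  where
  traceless₁ : + 3 * - (+ 3 * b) + b * + 9 - c * + 0 ≡ + 0
  traceless₁ = solve (b ∷ c ∷ [])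
  traceless₂ : + 3 * c + b * + 0 - c * + 3 ≡ + 0
  traceless₂ = solve (b ∷ c ∷ [])

reduction : ∀ a b c d {E₁ E₂} → TraceZeroBasis a b c d E₁ E₂ → HessianReduction a b c d E₁ E₂
reduction a b c d (case-b 3∣b) =
  shear-reduction a b c d (+ 0) (subst (+ 3 ∣_) b≡ 3∣b) (solve (b ∷ c ∷ []))
  where
  b≡ : b ≡ b - + 0 * c
  b≡ = solve (b ∷ c ∷ [])
reduction a b c d (case-c 3∣c) = swap-reduction a b c d 3∣c
reduction a b c d (case-b≡-c 3∣b+c) =
  shear-reduction a b c d (- + 1) (subst (+ 3 ∣_) b+c≡ 3∣b+c) (solve (b ∷ c ∷ []))
  where
  b+c≡ : b + c ≡ b - - + 1 * c
  b+c≡ = solve (b ∷ c ∷ [])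
reduction a b c d (case-b≡c 3∣b-c) =
  shear-reduction a b c d (+ 1) (subst (+ 3 ∣_) b-c≡ 3∣b-c) (solve (b ∷ c ∷ []))
  where
  b-c≡ : b - c ≡ b - + 1 * c
  b-c≡ = solve (b ∷ c ∷ [])

theorem5p5 : (a b c d : ℤ) →
    IrreducibleCubic a b c d →
    IsFundamental (discCubic a b c d) →
    ¬ ((+ 3) ∣ discCubic a b c d) →
    (E₁ E₂ : Elt) → TraceZeroBasis a b c d E₁ E₂ →
    (g : QF) → IsCForm (discCubic a b c d) g →
    ∃[ q ] ( IsHalfTraceForm a b c d E₁ E₂ q
           × ( Composes q g (hessian a b c d)
             ⊎ Composes q g (invQF (hessian a b c d)) ) )
theorem5p5 a b c d _ _ 3∤D _ _ basis g C-form =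
  q , isHalfTraceForm ,
  inj₁ (composes-with-CForm {f = q} {g} {hessian a b c d} A B C 3∤D
          (reduced-hessian⇒discCubic a b c d hessian∼) C-form q∼ hessian∼)
  where open HessianReduction (reduction a b c d basis)
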